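{- Let $G$ be a disconnected graph having exactly one nontrivial connected component and $t > 0$ trivial components. Then $h(G\overline{G}) \geq t+2$.
   Context: All graphs are finite, simple and undirected. For a graph $H$ and $x,y \in V(H)$, the closed interval $I[x,y]$ consists of $x$, $y$ and all vertices lying on some shortest path between $x$ and $y$ in $H$; for $S \subseteq V(H)$, $I[S] = \bigcup_{x,y\in S} I[x,y]$. A set $S$ is (geodetically) convex if $I[S]=S$; the convex hull $H(S)$ is the smallest convex set containing $S$; $S$ is a hull set if $H(S)=V(H)$; the (geodetic) hull number $h(H)$ is the minimum cardinality of a hull set of $H$. For a graph $G$ with vertex set $\{v_1,\dots,v_n\}$, the complementary prism $G\overline{G}$ has vertex set $\{v_1,\dots,v_n\}\cup\{\overline{v}_1,\dots,\overline{v}_n\}$ and edge set $E(G) \cup \{\overline{v}_i\overline{v}_j : i<j,\ v_iv_j\notin E(G)\} \cup \{v_i\overline{v}_i : 1\le i\le n\}$. A component is trivial if it has exactly one vertex, nontrivial otherwise. -}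

module Defs where

open import Data.Nat using (ℕ; zero; suc; _+_; _≤_)
open import Data.Fin using (Fin)
open import Data.Bool using (Bool; true; false)
open import Data.Sum using (_⊎_; inj₁; inj₂)
open import Data.Product using (_×_; ∃; ∃-syntax; Σ)
open import Data.List using (List)
open import Data.List.Membership.Propositional using (_∈_)
open import Relation.Binary.PropositionalEquality using (_≡_; _≢_)
open import Relation.Nullary using (¬_)
open import Level using (0ℓ)

record Graph (n : ℕ) : Set where
  field
    adj   : Fin n → Fin n → Bool
    sym   : ∀ i j → adj i j ≡ adj j i
    irrefl : ∀ i → adj i i ≡ false
open Graph public

data Walk {V : Set} (E : V → V → Set) : V → V → ℕ → Set where
  here : ∀ {x} → Walk E x x zero
  step : ∀ {x y z k} → E x y → Walk E y z k → Walk E x z (suc k)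

Dist : {V : Set} (E : V → V → Set) → V → V → ℕ → Set
Dist E x y k = Walk E x y k × (∀ m → Walk E x y m → k ≤ m)

Connected : {V : Set} (E : V → V → Set) → V → V → Set
Connected E x y = ∃[ k ] Walk E x y k

-- z ∈ I[x,y]: z lies on some shortest x–y path.
InInterval : {V : Set} (E : V → V → Set) → V → V → V → Set
InInterval E x y z =
  ∃[ k ] (Dist E x y k × ∃[ a ] ∃[ b ] (a + b ≡ k × Walk E x z a × Walk E z y b))

VSet : Set → Set₁
VSet V = V → Set

IntervalSet : {V : Set} (E : V → V → Set) → VSet V → VSet V
IntervalSet E S z = ∃[ x ] ∃[ y ] (S x × S y × InInterval E x y z)

-- S is geodetically convex: I[S] = S (I[S] ⊇ S always holds).
Convex : {V : Set} (E : V → V → Set) → VSet V → Set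
Convex E S = ∀ z → IntervalSet E S z → S z

Hull : {V : Set} (E : V → V → Set) → VSet V → V → Set₁
Hull E S z = ∀ (C : VSet _) → Convex E C → (∀ v → S v → C v) → C z

IsHullSet : {V : Set} (E : V → V → Set) → List V → Set₁
IsHullSet E S = ∀ v → Hull E (λ u → u ∈ S) v

Adj : ∀ {n} → Graph n → Fin n → Fin n → Set
Adj G i j = adj G i j ≡ true

-- Vertices of the complementary prism: inj₁ i = v_i, inj₂ i = v̄_i.
PrismV : ℕ → Set
PrismV n = Fin n ⊎ Fin n

PrismAdj : ∀ {n} → Graph n → PrismV n → PrismV n → Set
PrismAdj G (inj₁ i) (inj₁ j) = adj G i j ≡ true
PrismAdj G (inj₂ i) (inj₂ j) = i ≢ j × adj G i j ≡ false
PrismAdj G (inj₁ i) (inj₂ j) = i ≡ j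
PrismAdj G (inj₂ i) (inj₁ j) = i ≡ j

-- v is an isolated vertex of G (i.e. {v} is a trivial component).
Isolated : ∀ {n} → Graph n → Fin n → Set
Isolated G v = ∀ u → adj G v u ≡ false

Disconnected : ∀ {n} → Graph n → Set
Disconnected G = ∃[ x ] ∃[ y ] ¬ Connected (Adj G) x y

-- G has exactly one nontrivial component: some vertex lies in a
-- nontrivial component (is non-isolated), and any two vertices in
-- nontrivial components lie in the same component.
ExactlyOneNontrivialComponent : ∀ {n} → Graph n → Set
ExactlyOneNontrivialComponent G =
  (∃[ v ] ¬ Isolated G v) ×
  (∀ u v → ¬ Isolated G u → ¬ Isolated G v → Connected (Adj G) u v)

module Submission where

-- 1. Every isolated vertex v_i of G is a pendant vertex of GḠ (its only
--    neighbour is v̄_i), and a pendant vertex never lies inside a geodesic, so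
--    it belongs to every hull set: the t vertices v_i, i ∈ T, are in S.
-- 2. For any c, let D_c consist of v_d and v̄_d for d isolated or d = c.  D_c
--    is convex: distances from a vertex of D_c to the vertices outside are
--    bounded below by explicit "potentials" (functions changing by at most one
--    along edges), while vertices of D_c are joined by short explicit walks.
--    If c is not isolated, D_c misses the neighbours of c, so no hull set lies
--    inside D_c.  Since T ∪ {w} ⊆ D_c for a suitable non-isolated c, a hull set
--    must contain at least two vertices besides those of T.

open import Defs hiding (sym)
open import Data.Bool using (T; false)
import Data.Bool as Bool
open import Data.Bool.Properties using (not-¬; ¬-not)
open import Data.Empty using (⊥-elim)
open import Data.Fin using (Fin; _≟_)
open import Data.Fin.Properties using (all?; ¬∀⟶∃¬)
open import Data.List using (List; []; _∷_; _++_; length; map; filter)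
open import Data.List.Properties using (length-map; length-++-sucʳ)
open import Data.List.Membership.Propositional using (_∈_)
open import Data.List.Membership.Propositional.Properties
  using (∈-∃++; ∈-++⁻; ∈-++⁺ˡ; ∈-++⁺ʳ; ∈-map⁻; ∈-filter⁺; ∈-filter⁻)
import Data.List.Membership.DecPropositional as DecMembership
open import Data.List.Relation.Binary.Subset.Propositional using (_⊆_)
open import Data.List.Relation.Unary.All using (_∷_)
import Data.List.Relation.Unary.All as All
open import Data.List.Relation.Unary.All.Properties using (¬Any⇒All¬)
open import Data.List.Relation.Unary.Any using (here; there)
open import Data.List.Relation.Unary.AllPairs using (_∷_)
open import Data.List.Relation.Unary.Unique.Propositional using (Unique)
import Data.List.Relation.Unary.Unique.Propositional.Properties as Unique
open import Data.Nat using (ℕ; suc; _+_; _≤_; _<_; z≤n; s≤s; _<ᵇ_)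
open import Data.Nat.Properties
  using (≤-refl; ≤-trans; ≤-reflexive; ≤-<-trans; <-≤-trans; <⇒≱; <ᵇ⇒<; n≤1+n; m≤n+m;
         +-comm; +-suc; +-identityʳ; +-mono-≤; +-monoʳ-≤; +-monoˡ-≤)
open import Data.Product using (_×_; _,_; ∃-syntax; ∃₂; proj₁; proj₂)
open import Data.Sum using (_⊎_; inj₁; inj₂)
open import Data.Sum.Properties using (≡-dec; inj₁-injective)
open import Relation.Binary.Definitions using (Symmetric; DecidableEquality)
open import Relation.Binary.PropositionalEquality
  using (_≡_; _≢_; refl; sym; trans; cong; subst; ≢-sym)
open import Relation.Nullary using (¬_; Dec; yes; no; ¬?)
open import Relation.Nullary.Decidable using (_⊎-dec_; decidable-stable)

module WalkFacts {V : Set} (E : V → V → Set) where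

  _++ʷ_ : ∀ {x y z a b} → Walk E x y a → Walk E y z b → Walk E x z (a + b)
  here     ++ʷ w = w
  step e v ++ʷ w = step e (v ++ʷ w)

  reverse : Symmetric E → ∀ {x y k} → Walk E x y k → Walk E y x k
  reverse E-sym here = here
  reverse E-sym {k = suc k} (step e w) =
    subst (Walk E _ _) (+-comm k 1) (reverse E-sym w ++ʷ step (E-sym e) here)

  Lipschitz : (V → ℕ) → Set
  Lipschitz f = ∀ {u w} → E u w → f w ≤ suc (f u)

  potential-growth : ∀ {f} → Lipschitz f → ∀ {x y k} → Walk E x y k → f y ≤ k + f x
  potential-growth lip here = ≤-refl
  potential-growth {f} lip {x} (step {k = k} e w) =
    ≤-trans (potential-growth lip w)
            (≤-trans (+-monoʳ-≤ k (lip e)) (≤-reflexive (+-suc k (f x))))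

  potential-bound : ∀ {f} → Lipschitz f → ∀ {x y k} → f x ≡ 0 → Walk E x y k → f y ≤ k
  potential-bound lip {k = k} fx≡0 w =
    ≤-trans (potential-growth lip w)
            (≤-reflexive (trans (cong (k +_) fx≡0) (+-identityʳ k)))

  convex-criterion : ∀ {C : VSet V} → (∀ z → Dec (C z))
    → (∀ {x y z a b} → C x → C y → ¬ C z → Walk E x z a → Walk E z y b
         → ∃[ m ] (Walk E x y m × m < a + b))
    → Convex E C
  convex-criterion C? detour z (x , y , x∈C , y∈C , k , (_ , shortest) , a , b , a+b≡k , x→z , z→y)
    with C? z
  ... | yes z∈C = z∈C
  ... | no z∉C with detour x∈C y∈C z∉C x→z z→y
  ...   | m , x→y , m<a+b =
    ⊥-elim (<⇒≱ m<a+b (subst (_≤ m) (sym a+b≡k) (shortest m x→y)))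

  -- Dropping the two edges around a pendant vertex shortens a walk.
  shorter-by-two : ∀ a b → a + b < suc a + suc b
  shorter-by-two a b = s≤s (+-monoʳ-≤ a (n≤1+n b))

  module Pendant (E-sym : Symmetric E) (_≟ᵥ_ : DecidableEquality V)
                 {p q : V} (only-q : ∀ {w} → E p w → w ≡ q) where

    -- A pendant vertex p (whose only neighbour is q) is never an inner vertex
    -- of a geodesic: a walk x → q → p → q → y can skip p.
    complement-convex : Convex E (_≢ p)
    complement-convex = convex-criterion (λ z → ¬? (z ≟ᵥ p)) skip-p
      where
      skip-p : ∀ {x y z a b} → x ≢ p → y ≢ p → ¬ z ≢ p → Walk E x z a → Walk E z y b
             → ∃[ m ] (Walk E x y m × m < a + b)
      skip-p {z = z} x≢p y≢p z≡p x→z z→y with decidable-stable (z ≟ᵥ p) z≡p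
      ... | refl with reverse E-sym x→z | z→y
      ...   | here | _ = ⊥-elim (x≢p refl)
      ...   | _ | here = ⊥-elim (y≢p refl)
      ...   | step {k = a} e₁ q→x | step {k = b} e₂ q→y with only-q e₁ | only-q e₂
      ...     | refl | refl = a + b , reverse E-sym q→x ++ʷ q→y , shorter-by-two a b

    in-hull-set : ∀ {S} → IsHullSet E S → p ∈ S
    in-hull-set {S} hull with DecMembership._∈?_ _≟ᵥ_ p S
    ... | yes p∈S = p∈S
    ... | no p∉S =
      ⊥-elim (hull p (_≢ p) complement-convex
                   (λ v v∈S v≡p → p∉S (subst (_∈ S) v≡p v∈S)) refl)

module Counting {A : Set} (_≟ₐ_ : DecidableEquality A) where
  open DecMembership _≟ₐ_ using (_∈?_)

  unique-⊆-length : ∀ (xs ys : List A) → Unique xs → xs ⊆ ys → length xs ≤ length ys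
  unique-⊆-length [] ys _ _ = z≤n
  unique-⊆-length (x ∷ xs) ys (x∉xs ∷ uxs) xxs⊆ys with ∈-∃++ (xxs⊆ys (here refl))
  ... | us , vs , refl =
    ≤-trans (s≤s (unique-⊆-length xs (us ++ vs) uxs xs⊆usvs))
            (≤-reflexive (sym (length-++-sucʳ us x vs)))
    where
    xs⊆usvs : xs ⊆ us ++ vs
    xs⊆usvs v∈xs with ∈-++⁻ us (xxs⊆ys (there v∈xs))
    ... | inj₁ v∈us = ∈-++⁺ˡ v∈us
    ... | inj₂ (here refl) = ⊥-elim (All.lookup x∉xs v∈xs refl)
    ... | inj₂ (there v∈vs) = ∈-++⁺ʳ us v∈vs

  two-distinct-or-singleton : A → (R : List A) → Unique R
    → (∃₂ λ u v → u ≢ v × u ∈ R × v ∈ R) ⊎ (∃[ w ] R ⊆ w ∷ [])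
  two-distinct-or-singleton a [] _ = inj₂ (a , λ ())
  two-distinct-or-singleton _ (w ∷ []) _ = inj₂ (w , λ w∈ → w∈)
  two-distinct-or-singleton _ (u ∷ v ∷ _) ((u≢v ∷ _) ∷ _) =
    inj₁ (u , v , u≢v , here refl , there (here refl))

  outside : (T : List A) (u : A) → Dec (¬ u ∈ T)
  outside T u = ¬? (u ∈? T)

  two-beyond : A → ∀ {S T} → Unique S → Unique T → T ⊆ S
    → (∀ w → ¬ S ⊆ w ∷ T) → length T + 2 ≤ length S
  two-beyond a {S} {T} uS uT T⊆S not-covered
    with two-distinct-or-singleton a (filter (outside T) S) (Unique.filter⁺ (outside T) uS)
  ... | inj₂ (w , beyond⊆w) = ⊥-elim (not-covered w S⊆wT)
    where
    S⊆wT : S ⊆ w ∷ T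
    S⊆wT {u} u∈S with u ∈? T
    ... | yes u∈T = there u∈T
    ... | no u∉T with beyond⊆w (∈-filter⁺ (outside T) u∈S u∉T)
    ...   | here u≡w = here u≡w
  ... | inj₁ (u , v , u≢v , u∈R , v∈R) =
    subst (_≤ length S) (+-comm 2 (length T)) (unique-⊆-length (u ∷ v ∷ T) S unique-uvT uvT⊆S)
    where
    u-new : u ∈ S × ¬ u ∈ T
    u-new = ∈-filter⁻ (outside T) u∈R
    v-new : v ∈ S × ¬ v ∈ T
    v-new = ∈-filter⁻ (outside T) v∈R
    unique-uvT : Unique (u ∷ v ∷ T)
    unique-uvT = (u≢v ∷ ¬Any⇒All¬ T (proj₂ u-new)) ∷ ¬Any⇒All¬ T (proj₂ v-new) ∷ uT
    uvT⊆S : u ∷ v ∷ T ⊆ S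
    uvT⊆S (here refl) = proj₁ u-new
    uvT⊆S (there (here refl)) = proj₁ v-new
    uvT⊆S (there (there t∈T)) = T⊆S t∈T

module Prism {n : ℕ} (G : Graph n) where

  E : PrismV n → PrismV n → Set
  E = PrismAdj G

  open WalkFacts E

  prism-sym : Symmetric E
  prism-sym {inj₁ i} {inj₁ j} i~j = trans (Graph.sym G j i) i~j
  prism-sym {inj₂ i} {inj₂ j} (i≢j , i≁j) = ≢-sym i≢j , trans (Graph.sym G j i) i≁j
  prism-sym {inj₁ i} {inj₂ j} i≡j = sym i≡j
  prism-sym {inj₂ i} {inj₁ j} i≡j = sym i≡j

  _≟ᵥ_ : DecidableEquality (PrismV n)
  _≟ᵥ_ = ≡-dec _≟_ _≟_

  isolated? : ∀ d → Dec (Isolated G d)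
  isolated? d = all? (λ u → adj G d u Bool.≟ false)

  no-edge-from : ∀ {i k} → Isolated G i → ¬ Adj G i k
  no-edge-from {k = k} i-iso i~k = not-¬ i~k (i-iso k)

  no-edge-to : ∀ {i k} → Isolated G i → ¬ Adj G k i
  no-edge-to {i} {k} i-iso k~i = no-edge-from i-iso (trans (Graph.sym G i k) k~i)

  neighbour : ∀ {c} → ¬ Isolated G c → ∃[ d ] Adj G c d
  neighbour {c} c-active
    with ¬∀⟶∃¬ n (λ u → adj G c u ≡ false) (λ u → adj G c u Bool.≟ false) c-active
  ... | d , not-non-adjacent = d , ¬-not not-non-adjacent

  isolated-pendant : ∀ {i} → Isolated G i → ∀ {w} → E (inj₁ i) w → w ≡ inj₂ i
  isolated-pendant i-iso {inj₁ j} i~j = ⊥-elim (no-edge-from i-iso i~j)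
  isolated-pendant i-iso {inj₂ j} refl = refl

  -- Distance bounds use potentials that are constant on each layer except
  -- at one centre index; layer and index locate a prism vertex.
  data Layer : Set where
    upper lower : Layer

  layer : PrismV n → Layer
  layer (inj₁ _) = upper
  layer (inj₂ _) = lower

  index : PrismV n → Fin n
  index (inj₁ i) = i
  index (inj₂ i) = i

  onLayer : Layer → ℕ → ℕ → ℕ
  onLayer upper a _ = a
  onLayer lower _ c = c

  select : Fin n → Fin n → ℕ → ℕ → ℕ
  select i j a b with i ≟ j
  ... | yes _ = a
  ... | no _ = b

  select-self : ∀ i {a b} → select i i a b ≡ a
  select-self i with i ≟ i
  ... | yes _ = refl
  ... | no i≢i = ⊥-elim (i≢i refl)

  select-off : ∀ {i j a b} → i ≢ j → select i j a b ≡ b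
  select-off {i} {j} i≢j with i ≟ j
  ... | yes i≡j = ⊥-elim (i≢j i≡j)
  ... | no _ = refl

  level : Fin n → ℕ → ℕ → ℕ → ℕ → PrismV n → ℕ
  level i a b c d z = select i (index z) (onLayer (layer z) a c) (onLayer (layer z) b d)

  Near : ℕ → ℕ → Set
  Near a b = a ≤ suc b × b ≤ suc a

  near-suc : ∀ m → Near m (suc m)
  near-suc m = m≤n+m m 2 , ≤-refl

  near-pred : ∀ m → Near (suc m) m
  near-pred m = ≤-refl , m≤n+m m 2

  leave-centre : ∀ {i k a b} → Isolated G i ⊎ Near a b → Adj G i k → b ≤ suc a
  leave-centre (inj₁ i-iso) i~k = ⊥-elim (no-edge-from i-iso i~k)
  leave-centre (inj₂ ab) _ = proj₂ ab

  enter-centre : ∀ {i k a b} → Isolated G i ⊎ Near a b → Adj G k i → a ≤ suc b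
  enter-centre (inj₁ i-iso) k~i = ⊥-elim (no-edge-to i-iso k~i)
  enter-centre (inj₂ ab) _ = proj₁ ab

  -- A two-level potential is Lipschitz when values joined by possible edges
  -- are near; the upper condition is void if the centre is isolated.
  level-lipschitz : ∀ {i a b c d} → Isolated G i ⊎ Near a b → Near c d → Near a c → Near b d
    → Lipschitz (level i a b c d)
  level-lipschitz {i} ab cd ac bd {inj₁ j} {inj₁ k} j~k with i ≟ j | i ≟ k
  ... | yes refl | yes refl = n≤1+n _
  ... | yes refl | no _ = leave-centre ab j~k
  ... | no _ | yes refl = enter-centre ab j~k
  ... | no _ | no _ = n≤1+n _
  level-lipschitz {i} ab cd ac bd {inj₂ j} {inj₂ k} _ with i ≟ j | i ≟ k
  ... | yes refl | yes refl = n≤1+n _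
  ... | yes refl | no _ = proj₂ cd
  ... | no _ | yes refl = proj₁ cd
  ... | no _ | no _ = n≤1+n _
  level-lipschitz {i} ab cd ac bd {inj₁ j} {inj₂ .j} refl with i ≟ j
  ... | yes _ = proj₂ ac
  ... | no _ = proj₂ bd
  level-lipschitz {i} ab cd ac bd {inj₂ j} {inj₁ .j} refl with i ≟ j
  ... | yes _ = proj₁ ac
  ... | no _ = proj₁ bd

  module Core (c : Fin n) where

    InCore : Fin n → Set
    InCore d = Isolated G d ⊎ d ≡ c

    InD : PrismV n → Set
    InD z = InCore (index z)

    InD? : ∀ z → Dec (InD z)
    InD? z = isolated? (index z) ⊎-dec (index z ≟ c)

    separated : ∀ {i j} → InCore i → ¬ InCore j → i ≢ j
    separated i∈ j∉ refl = j∉ i∈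

    non-adjacent : ∀ {i j} → InCore i → InCore j → i ≢ j → adj G i j ≡ false
    non-adjacent (inj₁ i-iso) _ _ = i-iso _
    non-adjacent _ (inj₁ j-iso) _ = trans (Graph.sym G _ _) (j-iso _)
    non-adjacent (inj₂ refl) (inj₂ refl) i≢j = ⊥-elim (i≢j refl)

    potential : (x : PrismV n) → InD x → PrismV n → ℕ
    potential (inj₁ i) (inj₁ _) = level i 0 3 1 2
    potential (inj₁ i) (inj₂ _) = level i 0 1 1 2
    potential (inj₂ j) _        = level j 1 2 0 1

    -- Its value away from the centre: a lower bound on the distance from x to
    -- a vertex outside D_c on the given layer.
    gap : (x : PrismV n) → InD x → Layer → ℕ
    gap (inj₁ _) (inj₁ _) s = onLayer s 3 2
    gap (inj₁ _) (inj₂ _) s = onLayer s 1 2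
    gap (inj₂ _) _        s = onLayer s 2 1

    potential-lipschitz : ∀ x p → Lipschitz (potential x p)
    potential-lipschitz (inj₁ i) (inj₁ i-iso) =
      level-lipschitz (inj₁ i-iso) (near-suc 1) (near-suc 0) (near-pred 2)
    potential-lipschitz (inj₁ i) (inj₂ _) =
      level-lipschitz (inj₂ (near-suc 0)) (near-suc 1) (near-suc 0) (near-suc 1)
    potential-lipschitz (inj₂ j) _ =
      level-lipschitz (inj₂ (near-suc 1)) (near-suc 0) (near-pred 0) (near-pred 1)

    potential-zero : ∀ x p → potential x p x ≡ 0
    potential-zero (inj₁ i) (inj₁ _) = select-self i
    potential-zero (inj₁ i) (inj₂ _) = select-self i
    potential-zero (inj₂ j) _        = select-self j

    potential-off : ∀ x p z → index x ≢ index z → potential x p z ≡ gap x p (layer z)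
    potential-off (inj₁ _) (inj₁ _) _ x≢z = select-off x≢z
    potential-off (inj₁ _) (inj₂ _) _ x≢z = select-off x≢z
    potential-off (inj₂ _) _        _ x≢z = select-off x≢z

    far : ∀ {x z a} (p : InD x) → ¬ InD z → Walk E x z a → gap x p (layer z) ≤ a
    far {x} {z} p z∉D w =
      subst (_≤ _) (potential-off x p z (separated p z∉D))
            (potential-bound (potential-lipschitz x p) (potential-zero x p) w)

    Bounded : PrismV n → PrismV n → ℕ → Set
    Bounded x y k = ∃[ m ] (Walk E x y m × m ≤ k)

    -- The lower vertices of D_c form a clique; upper ones hang below them.
    lower-lower : ∀ {i j} → InCore i → InCore j → Bounded (inj₂ i) (inj₂ j) 1
    lower-lower {i} {j} i∈ j∈ with i ≟ j
    ... | yes refl = 0 , here , z≤n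
    ... | no i≢j = 1 , step (i≢j , non-adjacent i∈ j∈ i≢j) here , ≤-refl

    upper-lower : ∀ {i j} → InCore i → InCore j → Bounded (inj₁ i) (inj₂ j) 2
    upper-lower i∈ j∈ with lower-lower i∈ j∈
    ... | m , w , m≤1 = suc m , step refl w , s≤s m≤1

    upper-upper : ∀ {i j} → InCore i → InCore j → Bounded (inj₁ i) (inj₁ j) 3
    upper-upper i∈ j∈ with lower-lower i∈ j∈
    ... | m , w , m≤1 = suc (m + 1) , step refl (w ++ʷ step refl here) , s≤s (+-monoˡ-≤ 1 m≤1)

    Shortcut : (x y : PrismV n) → InD x → InD y → Set
    Shortcut x y p q = ∃[ m ] (Walk E x y m × ∀ s → m < gap x p s + gap y q s)

    shortcut-sym : ∀ {x y p q} → Shortcut y x q p → Shortcut x y p q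
    shortcut-sym {x} {y} {p} {q} (m , w , short) =
      m , reverse prism-sym w , λ s → subst (m <_) (+-comm (gap y q s) (gap x p s)) (short s)

    within : ∀ {x y} k (p : InD x) (q : InD y) → Bounded x y k
      → {T (k <ᵇ gap x p upper + gap y q upper)} → {T (k <ᵇ gap x p lower + gap y q lower)}
      → Shortcut x y p q
    within {x} {y} k p q (m , w , m≤k) {k<upper} {k<lower} = m , w , short
      where
      short : ∀ s → m < gap x p s + gap y q s
      short upper = ≤-<-trans m≤k (<ᵇ⇒< k _ k<upper)
      short lower = ≤-<-trans m≤k (<ᵇ⇒< k _ k<lower)

    -- Cases by layer; gaps of upper vertices depend on whether they are
    -- isolated or equal to c, and x = y = v_c needs the empty walk.
    upper-lower-shortcut : ∀ {i j} (p : InCore i) (q : InCore j) → Shortcut (inj₁ i) (inj₂ j) p q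
    upper-lower-shortcut p@(inj₁ _) q = within 2 p q (upper-lower p q)
    upper-lower-shortcut p@(inj₂ _) q = within 2 p q (upper-lower p q)

    shortcut : ∀ x y (p : InD x) (q : InD y) → Shortcut x y p q
    shortcut (inj₂ i) (inj₂ j) p q = within 1 p q (lower-lower p q)
    shortcut (inj₁ i) (inj₂ j) p q = upper-lower-shortcut p q
    shortcut (inj₂ i) (inj₁ j) p q = shortcut-sym {p = p} {q = q} (upper-lower-shortcut q p)
    shortcut (inj₁ i) (inj₁ j) p@(inj₁ _) q@(inj₁ _) = within 3 p q (upper-upper p q)
    shortcut (inj₁ i) (inj₁ j) p@(inj₁ _) q@(inj₂ _) = within 3 p q (upper-upper p q)
    shortcut (inj₁ i) (inj₁ j) p@(inj₂ _) q@(inj₁ _) = within 3 p q (upper-upper p q)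
    shortcut (inj₁ i) (inj₁ j) p@(inj₂ refl) q@(inj₂ refl) = within 0 p q (0 , here , z≤n)

    -- D_c is convex: a detour through z ∉ D_c has length at least the gap
    -- sum, which exceeds the length of the shortcut.
    D-convex : Convex E InD
    D-convex = convex-criterion InD? detour
      where
      detour : ∀ {x y z a b} → InD x → InD y → ¬ InD z → Walk E x z a → Walk E z y b
             → ∃[ m ] (Walk E x y m × m < a + b)
      detour {x} {y} {z} p q z∉D x→z z→y with shortcut x y p q
      ... | m , x→y , short =
        m , x→y , <-≤-trans (short (layer z))
                            (+-mono-≤ (far p z∉D x→z) (far q z∉D (reverse prism-sym z→y)))

    -- If c is not isolated, D_c misses every neighbour of c, so no hull set
    -- lies inside D_c.
    hull-set-escapes : ¬ Isolated G c → ∀ {S} → IsHullSet E S → ¬ (∀ {u} → u ∈ S → InD u)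
    hull-set-escapes c-active hull S⊆D with neighbour c-active
    ... | d , c~d with hull (inj₁ d) InD D-convex (λ _ → S⊆D)
    ...   | inj₁ d-iso = no-edge-to d-iso c~d
    ...   | inj₂ refl = not-¬ c~d (Graph.irrefl G c)


  open WalkFacts.Pendant E prism-sym _≟ᵥ_ using (in-hull-set)
  open Counting _≟ᵥ_ using (two-beyond)

  -- Given a non-isolated c₀, each vertex w lies in D_c for a non-isolated c:
  -- c is w's own index if that is not isolated, and c₀ otherwise.
  some-core : ∀ {c₀} → ¬ Isolated G c₀ → ∀ w → ∃[ c ] (¬ Isolated G c × Core.InD c w)
  some-core c₀-active w with isolated? (index w)
  ... | yes w-iso = _ , c₀-active , inj₁ w-iso
  ... | no w-active = index w , w-active , inj₂ refl

  hull-number-bound : ∀ {c₀} → ¬ Isolated G c₀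
    → (T : List (Fin n)) → Unique T → (∀ v → v ∈ T → Isolated G v)
    → ∀ {S} → Unique S → IsHullSet E S → length T + 2 ≤ length S
  hull-number-bound {c₀} c₀-active T uT T-iso {S} uS hull =
    subst (λ t → t + 2 ≤ length S) (length-map inj₁ T)
          (two-beyond (inj₁ c₀) uS (Unique.map⁺ inj₁-injective uT) pendants-in-S not-covered)
    where
    pendants-in-S : map inj₁ T ⊆ S
    pendants-in-S t∈ with ∈-map⁻ inj₁ t∈
    ... | i , i∈T , refl = in-hull-set (isolated-pendant (T-iso i i∈T)) hull

    not-covered : ∀ w → ¬ S ⊆ w ∷ map inj₁ T
    not-covered w S⊆wT with some-core c₀-active w
    ... | c , c-active , w∈D = Core.hull-set-escapes c c-active hull S⊆D
      where
      S⊆D : ∀ {u} → u ∈ S → Core.InD c u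
      S⊆D u∈S with S⊆wT u∈S
      ... | here refl = w∈D
      ... | there t∈ with ∈-map⁻ inj₁ t∈
      ...   | i , i∈T , refl = inj₁ (T-iso i i∈T)

theorem4 : (n : ℕ) (G : Graph n) → Disconnected G → ExactlyOneNontrivialComponent G
    → (T : List (Fin n)) → Unique T → (∀ v → (v ∈ T → Isolated G v) × (Isolated G v → v ∈ T))
    → 0 < length T
    → (S : List (PrismV n)) → Unique S → IsHullSet (PrismAdj G) S
    → length T + 2 ≤ length S
theorem4 n G _ ((c₀ , c₀-active) , _) T uT T-isolated _ S uS hull =
  Prism.hull-number-bound G c₀-active T uT (λ v → proj₁ (T-isolated v)) uS hull
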